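{- Let $g,h,i\in[0,d]$ and suppose $\mathbb P(i)=\mathbb P(g\oplus h)\cup\mathbb P$ where $\mathbb P\subseteq\mathbb P_2(g\cap h)$, and put $\mathbb Q=\mathbb P_2(g\cap h)\setminus\mathbb P$. Then $p_{gh}^i=\prod_{j\in\mathbb P}(u_j-2)\prod_{k\in\mathbb Q}(u_k-1)$ (empty products equal $1$). In particular $p_{gh}^i\ne0$.
   Context: Let $n\ge1$ and let $\mathbb U_1,\dots,\mathbb U_n$ be finite sets with $|\mathbb U_a|=u_a\ge2$. Put $\mathbb X=\prod_a\mathbb U_a$, $d=2^n-1$. For $g\in[0,d]$ with binary expansion $g=\sum_{a=1}^n g_{(a)}2^{a-1}$ let $\mathbb P(g)=\{a:g_{(a)}=1\}$ (a bijection between $[0,d]$ and subsets of $[1,n]$) and $\mathbb P_2(g)=\{a\in\mathbb P(g):u_a>2\}$. Let $R_g=\{(\mathbf u,\mathbf v)\in\mathbb X^2:\mathbf u_a\ne\mathbf v_a\iff a\in\mathbb P(g)\}$ (factorial association scheme). For $(\mathbf u,\mathbf v)\in R_i$, $p_{gh}^i=|\{\mathbf w:(\mathbf u,\mathbf w)\in R_g,(\mathbf w,\mathbf v)\in R_h\}|$. For $g,h\in[0,d]$: $g\cap h$, $g\setminus h$, $g\cup h$ are the elements whose $\mathbb P$ is the intersection, difference, union of $\mathbb P(g),\mathbb P(h)$; $g\oplus h=(g\setminus h)\cup(h\setminus g)$. -}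

module Defs where

open import Data.Nat using (ℕ; zero; suc; _*_; _<ᵇ_)
open import Data.Bool using (Bool; true; false; _∧_; if_then_else_)
open import Data.Fin using (Fin; zero; suc)
open import Data.Fin.Properties using (_≟_; all?)
open import Data.Fin.Subset using (Subset; _∈_; _∉_; _∪_; _─_; _∩_)
open import Data.Fin.Subset.Properties using (_∈?_)
open import Data.Vec using (Vec; []; _∷_; tabulate; lookup)
open import Data.List using (List; []; _∷_; concatMap; map; length; filter; allFin)
open import Data.Product using (_×_; _,_)
open import Relation.Binary.PropositionalEquality using (_≡_; _≢_)
open import Relation.Nullary using (Dec; ¬_)
open import Relation.Nullary.Decidable using (_×-dec_; _→-dec_; ¬?)

X : (n : ℕ) → (Fin n → ℕ) → Set
X n u = (a : Fin n) → Fin (u a)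

allX : (n : ℕ) (u : Fin n → ℕ) → List (X n u)
allX zero    u = (λ ()) ∷ []
allX (suc n) u =
  concatMap (λ x₀ → map (λ xs → cons x₀ xs) (allX n (λ a → u (suc a)))) (allFin (u zero))
  where
  cons : Fin (u zero) → X n (λ a → u (suc a)) → X (suc n) u
  cons x₀ xs zero    = x₀
  cons x₀ xs (suc a) = xs a

-- Elements g ∈ [0,d] are identified with the subsets ℙ(g) ⊆ [1,n] (Subset n).
-- Relation R_g : x and y differ exactly in the coordinates a ∈ ℙ(g).
R : {n : ℕ} {u : Fin n → ℕ} → Subset n → X n u → X n u → Set
R {n} g x y = (a : Fin n) → (a ∈ g → x a ≢ y a) × (a ∉ g → x a ≡ y a)

R? : {n : ℕ} {u : Fin n → ℕ} (g : Subset n) (x y : X n u) → Dec (R g x y)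
R? g x y = all? (λ a → ((a ∈? g) →-dec ¬? (x a ≟ y a)) ×-dec (¬? (a ∈? g) →-dec (x a ≟ y a)))

pAt : {n : ℕ} {u : Fin n → ℕ} (g h : Subset n) (x y : X n u) → ℕ
pAt {n} {u} g h x y =
  length (filter (λ w → R? g x w ×-dec R? h w y) (allX n u))

_⊕_ : {n : ℕ} → Subset n → Subset n → Subset n
g ⊕ h = (g ─ h) ∪ (h ─ g)

P₂ : {n : ℕ} → (Fin n → ℕ) → Subset n → Subset n
P₂ u g = tabulate (λ a → lookup g a ∧ (2 <ᵇ u a))

prodOver : {n : ℕ} → Subset n → (Fin n → ℕ) → ℕ
prodOver []          f = 1
prodOver (b ∷ S) f = (if b then f zero else 1) * prodOver S (λ a → f (suc a))

{-# OPTIONS --safe #-}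
-- Both R and the enumeration of 𝕏 are coordinatewise, so p^i_{gh}(x, y) is the product over the
-- coordinates a of the number of w_a ∈ 𝕌_a with the prescribed (in)equalities to x_a and y_a.
-- Outside g ∩ h that number is 1, since w_a is forced to be x_a or y_a; on g ∩ h it is u_a − 1
-- when x_a = y_a and u_a − 2 when x_a ≠ y_a, i.e. when a ∈ ℙ. A coordinate of g ∩ h with u_a = 2
-- contributes u_a − 1 = 1, which is why only ℙ₂(g ∩ h) ∖ ℙ appears in the product.
module Submission where

open import Defs
open import Data.Nat using (ℕ; _∸_; _≤_; _≥_; _*_)
open import Data.Fin using (Fin)
open import Data.Fin.Subset using (Subset; _⊆_; _∪_; _∩_; _─_)
open import Relation.Binary.PropositionalEquality using (_≡_; _≢_)
open import Data.Product using (_×_)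

open import Level using (Level)
open import Function using (_∘_; _⇔_; mk⇔; Equivalence)
open import Data.Bool using (Bool; true; false; not; _∧_; _∨_; _xor_; if_then_else_)
open import Data.Bool.Properties using (T-≡; T-∧; ∧-identityʳ; ∧-zeroʳ)
open import Data.Empty using (⊥-elim)
open import Data.Fin using (zero; suc)
open import Data.Fin.Properties using (_≟_)
open import Data.Fin.Subset using (_∈_)
open import Data.Fin.Subset.Properties using (drop-there; drop-∷-⊆)
open import Data.List using (List; []; _∷_; _++_; filter; length; map; concatMap; allFin; tabulate)
open import Data.List.Properties using (filter-≐; filter-++; length-++; map-tabulate; length-tabulate)
open import Data.Nat using (zero; suc; _+_; _<_; _<ᵇ_; NonZero; s≤s; ≢-nonZero⁻¹; >-nonZero)
open import Data.Nat.Properties using (*-commutativeSemigroup; *-identityʳ; +-identityʳ; *-distribʳ-+; m*n≢0; <ᵇ⇒<; m<n⇒0<n∸m)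
open import Data.Product using (_,_; proj₁; proj₂)
open import Algebra.Properties.CommutativeSemigroup *-commutativeSemigroup using (interchange)
open import Data.Vec using ([]; _∷_; here; there; lookup)
open import Data.Vec.Properties using ([]=⇒lookup; lookup∘tabulate)
open import Relation.Binary.PropositionalEquality using (_≗_; refl; sym; trans; cong; cong₂; subst; module ≡-Reasoning)
open import Relation.Nullary using (Dec; yes; no; does; ¬_; contradiction)
open import Relation.Nullary.Decidable using (_×-dec_; ¬?)
open import Relation.Unary using (Pred; Decidable; _≐_)

private variable
  p q r : Level
  A B C : Set
  m : ℕ

count : {P : Pred A p} → Decidable P → List A → ℕ
count P? = length ∘ filter P?

module _ {P : Pred A p} (P? : Decidable P) where

  count-++ : ∀ xs ys → count P? (xs ++ ys) ≡ count P? xs + count P? ys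
  count-++ xs ys = trans (cong length (filter-++ P? xs ys)) (length-++ (filter P? xs))

  count-map : (f : B → A) → ∀ xs → count P? (map f xs) ≡ count (P? ∘ f) xs
  count-map f []       = refl
  count-map f (x ∷ xs) with P? (f x)
  ... | yes _ = cong suc (count-map f xs)
  ... | no  _ = count-map f xs

  count-none : (∀ x → ¬ P x) → ∀ xs → count P? xs ≡ 0
  count-none ¬P []       = refl
  count-none ¬P (x ∷ xs) with P? x
  ... | yes px = ⊥-elim (¬P x px)
  ... | no  _  = count-none ¬P xs

  count-all : (∀ x → P x) → ∀ xs → count P? xs ≡ length xs
  count-all all-P []       = refl
  count-all all-P (x ∷ xs) with P? x
  ... | yes _  = cong suc (count-all all-P xs)
  ... | no ¬px = ⊥-elim (¬px (all-P x))

  count-≐ : {Q : Pred A q} (Q? : Decidable Q) → P ≐ Q → ∀ xs → count P? xs ≡ count Q? xs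
  count-≐ Q? P≐Q xs = cong length (filter-≐ P? Q? P≐Q xs)

  count-does-≗ : {Q : Pred A q} (Q? : Decidable Q) → does ∘ P? ≗ does ∘ Q? → count P? ≗ count Q?
  count-does-≗ Q? P≗Q []       = refl
  count-does-≗ Q? P≗Q (x ∷ xs) with does (P? x) | does (Q? x) | P≗Q x
  ... | true  | .true  | refl = cong suc (count-does-≗ Q? P≗Q xs)
  ... | false | .false | refl = count-does-≗ Q? P≗Q xs

  count-tabulate : (f : Fin m → A) → count P? (tabulate f) ≡ count (P? ∘ f) (allFin m)
  count-tabulate f = trans (cong (count P?) (sym (map-tabulate (λ i → i) f))) (count-map f (allFin _))

count-concatMap-map : (f : A → B → C) {P : Pred A p} {Q : Pred B q} {D : Pred C r}
  (P? : Decidable P) (Q? : Decidable Q) (D? : Decidable D) →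
  (∀ a b → D (f a b) ⇔ (P a × Q b)) →
  ∀ as bs → count D? (concatMap (λ a → map (f a) bs) as) ≡ count P? as * count Q? bs
count-concatMap-map f P? Q? D? D⇔P×Q []       bs = refl
count-concatMap-map f P? Q? D? D⇔P×Q (a ∷ as) bs = begin
  count D? (map (f a) bs ++ concatMap (λ a → map (f a) bs) as)
    ≡⟨ count-++ D? (map (f a) bs) _ ⟩
  count D? (map (f a) bs) + count D? (concatMap (λ a → map (f a) bs) as)
    ≡⟨ cong₂ _+_ (trans (count-map D? (f a) bs) row) (count-concatMap-map f P? Q? D? D⇔P×Q as bs) ⟩
  count P? (a ∷ []) * count Q? bs + count P? as * count Q? bs
    ≡⟨ sym (*-distribʳ-+ (count Q? bs) (count P? (a ∷ [])) (count P? as)) ⟩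
  (count P? (a ∷ []) + count P? as) * count Q? bs
    ≡⟨ cong (_* count Q? bs) (sym (count-++ P? (a ∷ []) as)) ⟩
  count P? (a ∷ as) * count Q? bs ∎
  where
  open ≡-Reasoning
  row : count (D? ∘ f a) bs ≡ count P? (a ∷ []) * count Q? bs
  row with P? a
  ... | yes pa = trans (count-≐ (D? ∘ f a) Q?
                   (proj₂ ∘ Equivalence.to (D⇔P×Q a _) , Equivalence.from (D⇔P×Q a _) ∘ (pa ,_)) bs)
                   (sym (+-identityʳ _))
  ... | no ¬pa = count-none (D? ∘ f a) (λ b → ¬pa ∘ proj₁ ∘ Equivalence.to (D⇔P×Q a b)) bs

-- suc w ≟ suc a is decided by w ≟ a, so the decisions compared below agree definitionally.
count-allFin-≡ : (a : Fin m) → count (_≟ a) (allFin m) ≡ 1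
count-allFin-≡ {suc m} zero = cong suc (trans (count-tabulate (_≟ zero) {m = m} suc)
  (count-none (λ (w : Fin m) → suc w ≟ zero) (λ _ ()) (allFin m)))
count-allFin-≡ {suc m} (suc a) = trans (count-tabulate (_≟ suc a) suc)
  (trans (count-does-≗ _ (_≟ a) (λ _ → refl) (allFin m)) (count-allFin-≡ a))

count-allFin-≢ : (a : Fin m) → count (¬? ∘ (_≟ a)) (allFin m) ≡ m ∸ 1
count-allFin-≢ {suc m} zero = trans (count-tabulate (¬? ∘ (_≟ zero)) {m = m} suc)
  (trans (count-all (λ (w : Fin m) → ¬? (suc w ≟ zero)) (λ _ ()) (allFin m)) (length-tabulate (λ i → i)))
count-allFin-≢ {suc (suc m)} (suc a) = cong suc (trans (count-tabulate (¬? ∘ (_≟ suc a)) suc)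
  (trans (count-does-≗ _ (¬? ∘ (_≟ a)) (λ _ → refl) (allFin (suc m))) (count-allFin-≢ a)))

count-allFin-≢≢ : {a b : Fin m} → a ≢ b →
  count (λ w → ¬? (w ≟ a) ×-dec ¬? (w ≟ b)) (allFin m) ≡ m ∸ 2
count-allFin-≢≢ {suc m} {zero} {zero} a≢b = ⊥-elim (a≢b refl)
count-allFin-≢≢ {suc m} {zero} {suc b} _ =
  trans (count-tabulate (λ w → ¬? (w ≟ zero) ×-dec ¬? (w ≟ suc b)) {m = m} suc)
  (trans (count-does-≗ _ (¬? ∘ (_≟ b)) (λ _ → refl) (allFin m)) (count-allFin-≢ b))
count-allFin-≢≢ {suc m} {suc a} {zero} _ =
  trans (count-tabulate (λ w → ¬? (w ≟ suc a) ×-dec ¬? (w ≟ zero)) {m = m} suc)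
  (trans (count-does-≗ _ (¬? ∘ (_≟ a)) (λ w → ∧-identityʳ _) (allFin m)) (count-allFin-≢ a))
count-allFin-≢≢ {suc (suc zero)} {suc zero} {suc zero} a≢b = ⊥-elim (a≢b refl)
count-allFin-≢≢ {suc (suc (suc m))} {suc a} {suc b} a≢b =
  cong suc (trans (count-tabulate (λ w → ¬? (w ≟ suc a) ×-dec ¬? (w ≟ suc b)) suc)
  (trans (count-does-≗ _ (λ w → ¬? (w ≟ a) ×-dec ¬? (w ≟ b)) (λ _ → refl) (allFin (suc (suc m))))
         (count-allFin-≢≢ (a≢b ∘ cong suc))))

R₁ : Bool → Fin m → Fin m → Set
R₁ true  s t = s ≢ t
R₁ false s t = s ≡ t

R₁? : (b : Bool) (s t : Fin m) → Dec (R₁ b s t)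
R₁? true  s t = ¬? (s ≟ t)
R₁? false s t = s ≟ t

pAt₁ : (b c : Bool) (s t : Fin m) → ℕ
pAt₁ {m} b c s t = count (λ w → R₁? b s w ×-dec R₁? c w t) (allFin m)

module _ {n : ℕ} {u : Fin (suc n) → ℕ} where

  tailX : X (suc n) u → X n (u ∘ suc)
  tailX x a = x (suc a)

  R-∷ : (b : Bool) (g : Subset n) (x w : X (suc n) u) →
    R (b ∷ g) x w ⇔ (R₁ b (x zero) (w zero) × R g (tailX x) (tailX w))
  R-∷ b g x w = mk⇔ (λ r → head b r , tail r) (λ (r₁ , r) → cons b r₁ r)
    where
    head : ∀ b → R (b ∷ g) x w → R₁ b (x zero) (w zero)
    head true  r = proj₁ (r zero) here
    head false r = proj₂ (r zero) (λ ())
    tail : R (b ∷ g) x w → R g (tailX x) (tailX w)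
    tail r a = proj₁ (r (suc a)) ∘ there , λ a∉g → proj₂ (r (suc a)) (a∉g ∘ drop-there)
    cons : ∀ b → R₁ b (x zero) (w zero) → R g (tailX x) (tailX w) → R (b ∷ g) x w
    cons true  r₁ r zero    = (λ _ → r₁) , (λ 0∉ → ⊥-elim (0∉ here))
    cons false r₁ r zero    = (λ ()) , (λ _ → r₁)
    cons b     r₁ r (suc a) = proj₁ (r a) ∘ drop-there , λ a∉g → proj₂ (r a) (a∉g ∘ there)

  pAt-∷ : (b c : Bool) (g h : Subset n) (x y : X (suc n) u) →
    pAt (b ∷ g) (c ∷ h) x y ≡ pAt₁ b c (x zero) (y zero) * pAt g h (tailX x) (tailX y)
  pAt-∷ b c g h x y =
    count-concatMap-map _
      (λ w₀ → R₁? b (x zero) w₀ ×-dec R₁? c w₀ (y zero))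
      (λ ws → R? g (tailX x) ws ×-dec R? h ws (tailX y))
      (λ w → R? (b ∷ g) x w ×-dec R? (c ∷ h) w y)
      (λ _ _ → path-∷ _)  -- applied to the point allX builds from a head and a tail
      (allFin (u zero)) (allX n (u ∘ suc))
    where
    path-∷ : ∀ w → (R (b ∷ g) x w × R (c ∷ h) w y) ⇔
      ((R₁ b (x zero) (w zero) × R₁ c (w zero) (y zero)) × (R g (tailX x) (tailX w) × R h (tailX w) (tailX y)))
    path-∷ w = mk⇔
      (λ (xw , wy) → let (xw₀ , xw′) = to (R-∷ b g x w) xw ; (wy₀ , wy′) = to (R-∷ c h w y) wy
                     in (xw₀ , wy₀) , (xw′ , wy′))
      (λ ((xw₀ , wy₀) , (xw′ , wy′)) → from (R-∷ b g x w) (xw₀ , xw′) , from (R-∷ c h w y) (wy₀ , wy′))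
      where open Equivalence

module _ {s t : Fin m} where

  pAt₁-ff : s ≡ t → pAt₁ false false s t ≡ 1
  pAt₁-ff refl = trans (count-≐ _ (_≟ s) (proj₂ , λ w≡s → sym w≡s , w≡s) (allFin m)) (count-allFin-≡ s)

  pAt₁-tf : s ≢ t → pAt₁ true false s t ≡ 1
  pAt₁-tf s≢t = trans (count-≐ _ (_≟ t) (proj₂ , λ w≡t → (λ s≡w → s≢t (trans s≡w w≡t)) , w≡t) (allFin m))
    (count-allFin-≡ t)

  pAt₁-ft : s ≢ t → pAt₁ false true s t ≡ 1
  pAt₁-ft s≢t = trans (count-≐ _ (_≟ s) (sym ∘ proj₁ , λ w≡s → sym w≡s , λ w≡t → s≢t (trans (sym w≡s) w≡t)) (allFin m))
    (count-allFin-≡ s)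

  pAt₁-tt-≡ : s ≡ t → pAt₁ true true s t ≡ m ∸ 1
  pAt₁-tt-≡ refl = trans (count-≐ _ (¬? ∘ (_≟ s)) (proj₂ , λ w≢s → w≢s ∘ sym , w≢s) (allFin m))
    (count-allFin-≢ s)

  pAt₁-tt-≢ : s ≢ t → pAt₁ true true s t ≡ m ∸ 2
  pAt₁-tt-≢ s≢t = trans (count-≐ _ (λ w → ¬? (w ≟ s) ×-dec ¬? (w ≟ t))
                     ((λ (s≢w , w≢t) → s≢w ∘ sym , w≢t) , (λ (w≢s , w≢t) → w≢s ∘ sym , w≢t)) (allFin m))
    (count-allFin-≢≢ s≢t)

pAt₁-factor : (b c p : Bool) {s t : Fin m} → 2 ≤ m → (p ≡ true → (b ∧ c) ∧ (2 <ᵇ m) ≡ true) →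
  R₁ ((b xor c) ∨ p) s t →
  pAt₁ b c s t ≡ (if p then m ∸ 2 else 1) * (if ((b ∧ c) ∧ (2 <ᵇ m)) ∧ not p then m ∸ 1 else 1)
pAt₁-factor false false false _ _ s≡t = pAt₁-ff s≡t
pAt₁-factor true  false false _ _ s≢t = pAt₁-tf s≢t
pAt₁-factor false true  false _ _ s≢t = pAt₁-ft s≢t
pAt₁-factor {suc zero}          true true false (s≤s ()) _ _
pAt₁-factor {suc (suc zero)}    true true false _ _ s≡t = pAt₁-tt-≡ s≡t
pAt₁-factor {suc (suc (suc _))} true true false _ _ s≡t = trans (pAt₁-tt-≡ s≡t) (sym (+-identityʳ _))
pAt₁-factor true true true _ p⇒Q s≢t rewrite p⇒Q refl = trans (pAt₁-tt-≢ s≢t) (sym (*-identityʳ _))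
pAt₁-factor false false true _ p⇒Q _ = contradiction (p⇒Q refl) λ ()
pAt₁-factor true  false true _ p⇒Q _ = contradiction (p⇒Q refl) λ ()
pAt₁-factor false true  true _ p⇒Q _ = contradiction (p⇒Q refl) λ ()

⊕-∷ : ∀ {n} (a b : Bool) (g h : Subset n) → (a ∷ g) ⊕ (b ∷ h) ≡ (a xor b) ∷ (g ⊕ h)
⊕-∷ true  true  g h = refl
⊕-∷ true  false g h = refl
⊕-∷ false true  g h = refl
⊕-∷ false false g h = refl

─-∷ : ∀ {n} (a b : Bool) (g h : Subset n) → (a ∷ g) ─ (b ∷ h) ≡ (a ∧ not b) ∷ (g ─ h)
─-∷ a true  g h = cong (_∷ (g ─ h)) (sym (∧-zeroʳ a))
─-∷ a false g h = cong (_∷ (g ─ h)) (sym (∧-identityʳ a))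

pAt-product : ∀ n (u : Fin n → ℕ) → (∀ a → u a ≥ 2) → (g h P : Subset n) → P ⊆ P₂ u (g ∩ h) →
  {x y : X n u} → R ((g ⊕ h) ∪ P) x y →
  pAt g h x y ≡ prodOver P (λ j → u j ∸ 2) * prodOver (P₂ u (g ∩ h) ─ P) (λ k → u k ∸ 1)
pAt-product zero    u u≥2 [] [] [] _ _ = refl
pAt-product (suc n) u u≥2 (b ∷ g) (c ∷ h) (p ∷ P) P⊆ {x} {y} r = begin
  pAt (b ∷ g) (c ∷ h) x y
    ≡⟨ pAt-∷ b c g h x y ⟩
  pAt₁ b c (x zero) (y zero) * pAt g h (tailX x) (tailX y)
    ≡⟨ cong₂ _*_ (pAt₁-factor b c p (u≥2 zero) p⇒Q (proj₁ r-∷))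
                 (pAt-product n (u ∘ suc) (u≥2 ∘ suc) g h P (drop-∷-⊆ P⊆) (proj₂ r-∷)) ⟩
  (α * β) * (γ * δ)
    ≡⟨ interchange α β γ δ ⟩
  (α * γ) * (β * δ)
    ≡⟨ cong (λ S → prodOver (p ∷ P) (λ j → u j ∸ 2) * prodOver S (λ k → u k ∸ 1))
            (sym (─-∷ Q p (P₂ (u ∘ suc) (g ∩ h)) P)) ⟩
  prodOver (p ∷ P) (λ j → u j ∸ 2) * prodOver (P₂ u ((b ∷ g) ∩ (c ∷ h)) ─ (p ∷ P)) (λ k → u k ∸ 1) ∎
  where
  open ≡-Reasoning
  Q : Bool
  Q = (b ∧ c) ∧ (2 <ᵇ u zero)
  α β γ δ : ℕ
  α = if p then u zero ∸ 2 else 1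
  β = if Q ∧ not p then u zero ∸ 1 else 1
  γ = prodOver P (λ j → u (suc j) ∸ 2)
  δ = prodOver (P₂ (u ∘ suc) (g ∩ h) ─ P) (λ k → u (suc k) ∸ 1)
  p⇒Q : p ≡ true → Q ≡ true
  p⇒Q refl = []=⇒lookup (P⊆ here)
  r-∷ : R₁ ((b xor c) ∨ p) (x zero) (y zero) × R ((g ⊕ h) ∪ P) (tailX x) (tailX y)
  r-∷ = Equivalence.to (R-∷ _ _ x y) (subst (λ i → R (i ∪ (p ∷ P)) x y) (⊕-∷ b c g h) r)

prodOver-nonZero : ∀ {n} (S : Subset n) (f : Fin n → ℕ) → (∀ {a} → a ∈ S → NonZero (f a)) →
  NonZero (prodOver S f)
prodOver-nonZero []          _ _  = _
prodOver-nonZero (true ∷ S)  f nz = m*n≢0 (f zero) _ {{nz here}} {{prodOver-nonZero S (f ∘ suc) (nz ∘ there)}}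
prodOver-nonZero (false ∷ S) f nz = m*n≢0 1 _ {{_}} {{prodOver-nonZero S (f ∘ suc) (nz ∘ there)}}

∈P₂⇒2< : ∀ {n} (u : Fin n → ℕ) (S : Subset n) {a : Fin n} → a ∈ P₂ u S → 2 < u a
∈P₂⇒2< u S {a} a∈P₂ = <ᵇ⇒< 2 (u a) (proj₂ (Equivalence.to T-∧ (Equivalence.from T-≡
  (trans (sym (lookup∘tabulate (λ a → lookup S a ∧ (2 <ᵇ u a)) a)) ([]=⇒lookup a∈P₂)))))

-- The formula also holds for n = 0 (both sides are 1).
lemma4p4 : (n : ℕ) → 1 ≤ n → (u : Fin n → ℕ) → ((a : Fin n) → u a ≥ 2) →
    (g h i : Subset n) (P : Subset n) → P ⊆ P₂ u (g ∩ h) → i ≡ (g ⊕ h) ∪ P →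
    (x y : X n u) → R i x y →
    (pAt g h x y ≡ prodOver P (λ j → u j ∸ 2) * prodOver (P₂ u (g ∩ h) ─ P) (λ k → u k ∸ 1))
      × (pAt g h x y ≢ 0)
lemma4p4 n _ u u≥2 g h _ P P⊆ refl x y r rewrite pAt-product n u u≥2 g h P P⊆ r =
  refl , ≢-nonZero⁻¹ _ {{m*n≢0 _ _ {{nonZero-P}} {{nonZero-Q}}}}
  where
  nonZero-P : NonZero (prodOver P (λ j → u j ∸ 2))
  nonZero-P = prodOver-nonZero P _ (>-nonZero ∘ m<n⇒0<n∸m ∘ ∈P₂⇒2< u (g ∩ h) ∘ P⊆)
  nonZero-Q : NonZero (prodOver (P₂ u (g ∩ h) ─ P) (λ k → u k ∸ 1))
  nonZero-Q = prodOver-nonZero (P₂ u (g ∩ h) ─ P) _ λ {a} _ → >-nonZero (m<n⇒0<n∸m (u≥2 a))
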